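{- For every integer $k \ge 1$, the function $f_k(\lambda) = \dfrac{e^{ -\lambda}}{(1-e^{ -\lambda})^k}$ has a Laurent expansion $f_k(\lambda) = \sum_{j=-k}^{\infty} c_j \lambda^j$ about $\lambda = 0$ (valid for $0<|\lambda|<2\pi$), and its constant term satisfies $$c_0 = (-1)^k G_k,$$ where $G_k$ is the $k$-th Gregory coefficient. (Here $f_k(\lambda)$ is the generating function $\frac{x}{(1-x)^k} = \sum_{n=1}^\infty \binom{n+k-1}{n} x^n$ of the figurate binomial numbers evaluated at $x=e^{ -\lambda}$, so $c_0$ is the constant term of its asymptotic expansion as $x = e^{ -\lambda}\to 1^-$.)
   Context: The Gregory coefficients $G_n$ are defined by $\frac{x}{\ln(1+x)} = \sum_{n=0}^{\infty} G_n x^n$ for $|x|<1$; thus $G_0=1$, $G_1=\tfrac12$, $G_2=-\tfrac1{12}$, $G_3=\tfrac1{24}$, $G_4=-\tfrac{19}{720}$, $G_5 = \tfrac{3}{160}$, $G_6=-\tfrac{863}{60480}$. -}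

module Defs where

open import Data.Nat as ℕ using (ℕ; zero; suc; _!; _∸_)
open import Data.Nat.Properties using (_!≢0)
open import Data.Integer as ℤ using (ℤ; +_; -[1+_])
open import Data.Rational using (ℚ; 0ℚ; 1ℚ; _+_; _*_; -_; _/_)
open import Data.List using (List; []; _∷_)

-- Formal power series over ℚ: coefficient sequences  a : ℕ → ℚ
-- (a n = coefficient of t^n).
Series : Set
Series = ℕ → ℚ

sgn : ℕ → ℚ
sgn zero = 1ℚ
sgn (suc n) = - sgn n

sumTo : ℕ → (ℕ → ℚ) → ℚ
sumTo zero f = f zero
sumTo (suc n) f = sumTo n f + f (suc n)

_⊛_ : Series → Series → Series
(a ⊛ b) n = sumTo n (λ i → a i * b (n ∸ i))

one : Series
one zero = 1ℚ
one (suc _) = 0ℚ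

pow : Series → ℕ → Series
pow a zero = one
pow a (suc k) = a ⊛ pow a k

-- Multiplicative inverse of a series with constant term 1:
-- b 0 = 1,  b (n+1) = - Σ_{i=1}^{n+1} a i * b (n+1-i).
-- invRev a n is the list [b n, b (n-1), ..., b 0].
private
  dotShift : Series → ℕ → List ℚ → ℚ
  dotShift a i [] = 0ℚ
  dotShift a i (x ∷ xs) = a (suc i) * x + dotShift a (suc i) xs

  headOr0 : List ℚ → ℚ
  headOr0 [] = 0ℚ
  headOr0 (x ∷ _) = x

invRev : Series → ℕ → List ℚ
invRev a zero = 1ℚ ∷ []
invRev a (suc n) = (- dotShift a 0 (invRev a n)) ∷ invRev a n

-- inverse series (meaningful when a 0 = 1)
inv : Series → Series
inv a n = headOr0 (invRev a n)

-- e^{-λ} = Σ (-1)^n λ^n / n!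
expNeg : Series
expNeg n = sgn n * ((+ 1) / (n !)) where instance _ = n !≢0

-- (1 - e^{-λ}) / λ = Σ (-1)^n λ^n / (n+1)!
oneMinusExpNegOverλ : Series
oneMinusExpNegOverλ n = sgn n * ((+ 1) / (suc n !)) where instance _ = suc n !≢0

-- Laurent coefficients of f_k(λ) = e^{-λ} / (1 - e^{-λ})^k at λ = 0.
-- Since 1 - e^{-λ} = λ·h(λ) with h(0) = 1, f_k(λ) = λ^{-k} · e^{-λ} · h(λ)^{-k},
-- so c_j = [λ^{j+k}] (e^{-λ} · (1/h)^k) for j ≥ -k, and c_j = 0 for j < -k.
laurentCoeff : ℕ → ℤ → ℚ
laurentCoeff k j with j ℤ.+ (+ k)
... | + m = (expNeg ⊛ pow (inv oneMinusExpNegOverλ) k) m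
... | -[1+ _ ] = 0ℚ

-- ln(1+x)/x = Σ (-1)^n x^n / (n+1)
logOverX : Series
logOverX n = sgn n * ((+ 1) / suc n)

-- Gregory coefficients: x / ln(1+x) = Σ G n x^n
G : ℕ → ℚ
G = inv logOverX

-- Write E = e^{−λ}, h = (1 − e^{−λ})/λ, H = 1/h and X = λh = 1 − e^{−λ}, so that
-- c_k = [λ^k] E H^k.  As dX = E dλ, two residue computations drive the proof; formal
-- power series having no negative powers, both are carried out with the Euler operator
-- θ = λ d/dλ.  First, [λ^n] E H^{n+1} is the residue of dX/X^{n+1}, i.e. δ_{n0}.
-- Second, Σ_{m≤n} X^{m+1}/(m+1) ≡ λ mod λ^{n+2}, because −log(1 − X) = λ.
-- Since X^{m+1} H^{m+1} = λ^{m+1}, c_{n−m} = [λ^{n+1}] E H^{n+1} X^{m+1}, so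
-- Σ_{m≤n} c_{n−m}/(m+1) = [λ^{n+1}] E H^{n+1} λ = [λ^n] E H^{n+1} = δ_{n0}, that is,
-- (Σ c_k t^k)(−log(1 − t)/t) = 1.
-- Substituting t = −x gives Σ (−1)^k c_k x^k = x/log(1 + x) = Σ G_k x^k.

{-# OPTIONS --safe #-}
module Submission where

open import Algebra.Bundles using (CommutativeSemigroup)
open import Data.List using (List)
open import Data.Nat as ℕ using (ℕ; zero; suc; _∸_; _!; _≤_; _<_; z≤n; s≤s; NonZero)
import Data.Nat.Properties as ℕP
open import Data.Nat.Properties using (_!≢0)
open import Data.Integer using (+_)
import Data.Integer as ℤ
import Data.Integer.Properties as ℤP
open import Data.Product using (Σ; _,_; proj₁)
open import Data.Rational using (ℚ; 0ℚ; 1ℚ; _+_; _*_; -_; _/_; fromℚᵘ; +-0-rawMonoid)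
import Data.Rational.Properties as ℚP
open import Data.Rational.Solver using (module +-*-Solver)
open import Data.Rational.Unnormalised as ℚᵘ using (mkℚᵘ)
import Data.Rational.Unnormalised.Properties as ℚᵘP
open import Level using (0ℓ)
open import Relation.Binary.Bundles using (Setoid)
open import Relation.Binary.PropositionalEquality
  using (_≡_; _≗_; _→-setoid_; refl; sym; trans; cong; cong₂; subst; module ≡-Reasoning)

open import Defs
open import Algebra.Definitions.RawMonoid +-0-rawMonoid using (_×_)
open Setoid (ℕ →-setoid ℚ) using () renaming (sym to ≗-sym; trans to ≗-trans)
open +-*-Solver

ι : ℕ → ℚ
ι n = n × 1ℚ

recip : (n : ℕ) → .{{NonZero n}} → ℚ
recip n = + 1 / n

fromℚᵘ-homo-+ : ∀ p q → fromℚᵘ (p ℚᵘ.+ q) ≡ fromℚᵘ p + fromℚᵘ q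
fromℚᵘ-homo-+ p q = ℚP.toℚᵘ-injective (ℚᵘP.≃-trans (ℚP.toℚᵘ-fromℚᵘ (p ℚᵘ.+ q))
  (ℚᵘP.≃-sym (ℚᵘP.≃-trans (ℚP.toℚᵘ-homo-+ (fromℚᵘ p) (fromℚᵘ q))
    (ℚᵘP.+-cong (ℚP.toℚᵘ-fromℚᵘ p) (ℚP.toℚᵘ-fromℚᵘ q)))))

fromℚᵘ-homo-* : ∀ p q → fromℚᵘ (p ℚᵘ.* q) ≡ fromℚᵘ p * fromℚᵘ q
fromℚᵘ-homo-* p q = ℚP.toℚᵘ-injective (ℚᵘP.≃-trans (ℚP.toℚᵘ-fromℚᵘ (p ℚᵘ.* q))
  (ℚᵘP.≃-sym (ℚᵘP.≃-trans (ℚP.toℚᵘ-homo-* (fromℚᵘ p) (fromℚᵘ q))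
    (ℚᵘP.*-cong (ℚP.toℚᵘ-fromℚᵘ p) (ℚP.toℚᵘ-fromℚᵘ q)))))

ι≡n/1 : ∀ n → ι n ≡ + n / 1
ι≡n/1 zero = refl
ι≡n/1 (suc n) = begin
    1ℚ + ι n
  ≡⟨ cong (λ x → 1ℚ + x) (ι≡n/1 n) ⟩
    fromℚᵘ (mkℚᵘ (+ 1) 0) + fromℚᵘ (mkℚᵘ (+ n) 0)
  ≡⟨ sym (fromℚᵘ-homo-+ (mkℚᵘ (+ 1) 0) (mkℚᵘ (+ n) 0)) ⟩
    (+ 1 ℤ.+ (+ n ℤ.* + 1)) / 1
  ≡⟨ cong (λ m → (+ 1 ℤ.+ m) / 1) (ℤP.*-identityʳ (+ n)) ⟩
    + suc n / 1
  ∎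
  where open ≡-Reasoning

ι*recip≡1 : ∀ m → ι (suc m) * recip (suc m) ≡ 1ℚ
ι*recip≡1 m = begin
    ι (suc m) * recip (suc m)
  ≡⟨ cong (_* recip (suc m)) (ι≡n/1 (suc m)) ⟩
    fromℚᵘ (mkℚᵘ (+ suc m) 0) * fromℚᵘ (mkℚᵘ (+ 1) m)
  ≡⟨ sym (fromℚᵘ-homo-* (mkℚᵘ (+ suc m) 0) (mkℚᵘ (+ 1) m)) ⟩
    fromℚᵘ (mkℚᵘ (+ suc m) 0 ℚᵘ.* mkℚᵘ (+ 1) m)
  ≡⟨ ℚP.fromℚᵘ-cong (ℚᵘP.*-inverseʳ (mkℚᵘ (+ suc m) 0)) ⟩
    1ℚ
  ∎
  where open ≡-Reasoning

recip-* : ∀ m n .{{_ : NonZero n}} →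
          recip (suc m ℕ.* n) {{ℕP.m*n≢0 (suc m) n}} ≡ recip (suc m) * recip n
recip-* m (suc n) = fromℚᵘ-homo-* (mkℚᵘ (+ 1) m) (mkℚᵘ (+ 1) n)

recip-!-suc : ∀ n → ι (suc n) * recip (suc n !) {{suc n !≢0}} ≡ recip (n !) {{n !≢0}}
recip-!-suc n = begin
    ι (suc n) * recip (suc n !)
  ≡⟨ cong (ι (suc n) *_) (recip-* n (n !)) ⟩
    ι (suc n) * (recip (suc n) * recip (n !))
  ≡⟨ sym (ℚP.*-assoc (ι (suc n)) (recip (suc n)) (recip (n !))) ⟩
    ι (suc n) * recip (suc n) * recip (n !)
  ≡⟨ cong (_* recip (n !)) (ι*recip≡1 n) ⟩
    1ℚ * recip (n !)
  ≡⟨ ℚP.*-identityˡ (recip (n !)) ⟩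
    recip (n !)
  ∎
  where
  open ≡-Reasoning
  instance
    _ = n !≢0
    _ = suc n !≢0

ι-cancel : ∀ m {x y} → ι (suc m) * x ≡ ι (suc m) * y → x ≡ y
ι-cancel m {x} {y} eq = trans (sym (undo x)) (trans (cong (recip (suc m) *_) eq) (undo y))
  where
  undo : ∀ z → recip (suc m) * (ι (suc m) * z) ≡ z
  undo z = begin
      recip (suc m) * (ι (suc m) * z)
    ≡⟨ sym (ℚP.*-assoc (recip (suc m)) (ι (suc m)) z) ⟩
      recip (suc m) * ι (suc m) * z
    ≡⟨ cong (_* z) (trans (ℚP.*-comm (recip (suc m)) (ι (suc m))) (ι*recip≡1 m)) ⟩
      1ℚ * z
    ≡⟨ ℚP.*-identityˡ z ⟩
      z
    ∎
    where open ≡-Reasoning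

sgn-+ : ∀ m n → sgn (m ℕ.+ n) ≡ sgn m * sgn n
sgn-+ zero n = sym (ℚP.*-identityˡ (sgn n))
sgn-+ (suc m) n = trans (cong -_ (sgn-+ m n)) (ℚP.neg-distribˡ-* (sgn m) (sgn n))

sgn*sgn≡1 : ∀ n → sgn n * sgn n ≡ 1ℚ
sgn*sgn≡1 zero = refl
sgn*sgn≡1 (suc n) = trans (solve 1 (λ s → (:- s) :* (:- s) := s :* s) refl (sgn n)) (sgn*sgn≡1 n)

sumTo-cong-≤ : ∀ n {f g : ℕ → ℚ} → (∀ i → i ≤ n → f i ≡ g i) → sumTo n f ≡ sumTo n g
sumTo-cong-≤ zero eq = eq 0 z≤n
sumTo-cong-≤ (suc n) eq =
  cong₂ _+_ (sumTo-cong-≤ n (λ i i≤n → eq i (ℕP.m≤n⇒m≤1+n i≤n))) (eq (suc n) ℕP.≤-refl)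

sumTo-cong : ∀ n {f g : ℕ → ℚ} → f ≗ g → sumTo n f ≡ sumTo n g
sumTo-cong n eq = sumTo-cong-≤ n (λ i _ → eq i)

sumTo-distrib-+ : ∀ n (f g : ℕ → ℚ) → sumTo n (λ i → f i + g i) ≡ sumTo n f + sumTo n g
sumTo-distrib-+ zero f g = refl
sumTo-distrib-+ (suc n) f g = trans (cong (_+ (f (suc n) + g (suc n))) (sumTo-distrib-+ n f g))
  (solve 4 (λ F G x y → (F :+ G) :+ (x :+ y) := (F :+ x) :+ (G :+ y)) refl
     (sumTo n f) (sumTo n g) (f (suc n)) (g (suc n)))

*-distribˡ-sumTo : ∀ n c (f : ℕ → ℚ) → c * sumTo n f ≡ sumTo n (λ i → c * f i)
*-distribˡ-sumTo zero c f = refl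
*-distribˡ-sumTo (suc n) c f =
  trans (ℚP.*-distribˡ-+ c (sumTo n f) (f (suc n))) (cong (_+ (c * f (suc n))) (*-distribˡ-sumTo n c f))

neg-distrib-sumTo : ∀ n (f : ℕ → ℚ) → - sumTo n f ≡ sumTo n (λ i → - f i)
neg-distrib-sumTo zero f = refl
neg-distrib-sumTo (suc n) f =
  trans (ℚP.neg-distrib-+ (sumTo n f) (f (suc n))) (cong (_+ (- f (suc n))) (neg-distrib-sumTo n f))

sumTo-zero : ∀ n → sumTo n (λ _ → 0ℚ) ≡ 0ℚ
sumTo-zero zero = refl
sumTo-zero (suc n) = cong (_+ 0ℚ) (sumTo-zero n)

sumTo-sucˡ : ∀ n (f : ℕ → ℚ) → sumTo (suc n) f ≡ f 0 + sumTo n (λ i → f (suc i))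
sumTo-sucˡ zero f = refl
sumTo-sucˡ (suc n) f = trans (cong (_+ f (suc (suc n))) (sumTo-sucˡ n f))
  (ℚP.+-assoc (f 0) (sumTo n (λ i → f (suc i))) (f (suc (suc n))))

sumTo-comm : ∀ m n (f : ℕ → ℕ → ℚ) →
             sumTo m (λ i → sumTo n (f i)) ≡ sumTo n (λ j → sumTo m (λ i → f i j))
sumTo-comm zero n f = refl
sumTo-comm (suc m) n f = trans (cong (_+ sumTo n (f (suc m))) (sumTo-comm m n f))
  (sym (sumTo-distrib-+ n (λ j → sumTo m (λ i → f i j)) (f (suc m))))

infixl 6 _⊕_
infix 8 ⊖_
infixr 7 _•_

_⊕_ : Series → Series → Series
(a ⊕ b) n = a n + b n

⊖_ : Series → Series
(⊖ a) n = - a n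

_•_ : ℚ → Series → Series
(c • a) n = c * a n

zeros : Series
zeros _ = 0ℚ

shift : Series → Series
shift a zero = 0ℚ
shift a (suc n) = a n

tail : Series → Series
tail a n = a (suc n)

⊛-congˡ-≤ : ∀ a {b c} N → (∀ j → j ≤ N → b j ≡ c j) → (a ⊛ b) N ≡ (a ⊛ c) N
⊛-congˡ-≤ a N eq = sumTo-cong-≤ N (λ i i≤N → cong (a i *_) (eq (N ∸ i) (ℕP.m∸n≤m N i)))

⊛-congˡ : ∀ a {b c} → b ≗ c → a ⊛ b ≗ a ⊛ c
⊛-congˡ a eq N = ⊛-congˡ-≤ a N (λ j _ → eq j)

⊛-congʳ : ∀ {a b} → a ≗ b → ∀ c → a ⊛ c ≗ b ⊛ c
⊛-congʳ eq c n = sumTo-cong n (λ i → cong (_* c (n ∸ i)) (eq i))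

⊛-sucˡ : ∀ a b n → (a ⊛ b) (suc n) ≡ a 0 * b (suc n) + (tail a ⊛ b) n
⊛-sucˡ a b n = sumTo-sucˡ n (λ i → a i * b (suc n ∸ i))

⊛-sucʳ : ∀ a b n → (a ⊛ b) (suc n) ≡ (a ⊛ tail b) n + a (suc n) * b 0
⊛-sucʳ a b n = cong₂ _+_
  (sumTo-cong-≤ n (λ i i≤n → cong (λ j → a i * b j) (ℕP.+-∸-assoc 1 i≤n)))
  (cong (λ j → a (suc n) * b j) (ℕP.n∸n≡0 n))

⊛-comm : ∀ a b → a ⊛ b ≗ b ⊛ a
⊛-comm a b zero = ℚP.*-comm (a 0) (b 0)
⊛-comm a b (suc n) = begin
    (a ⊛ b) (suc n)
  ≡⟨ ⊛-sucˡ a b n ⟩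
    a 0 * b (suc n) + (tail a ⊛ b) n
  ≡⟨ cong (λ x → a 0 * b (suc n) + x) (⊛-comm (tail a) b n) ⟩
    a 0 * b (suc n) + (b ⊛ tail a) n
  ≡⟨ solve 3 (λ x y T → x :* y :+ T := T :+ y :* x) refl (a 0) (b (suc n)) ((b ⊛ tail a) n) ⟩
    (b ⊛ tail a) n + b (suc n) * a 0
  ≡⟨ sym (⊛-sucʳ b a n) ⟩
    (b ⊛ a) (suc n)
  ∎
  where open ≡-Reasoning

⊛-distribˡ-⊕ : ∀ a b c → a ⊛ (b ⊕ c) ≗ a ⊛ b ⊕ a ⊛ c
⊛-distribˡ-⊕ a b c n =
  trans (sumTo-cong n (λ i → ℚP.*-distribˡ-+ (a i) (b (n ∸ i)) (c (n ∸ i)))) (sumTo-distrib-+ n _ _)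

⊛-distribʳ-⊕ : ∀ a b c → (a ⊕ b) ⊛ c ≗ a ⊛ c ⊕ b ⊛ c
⊛-distribʳ-⊕ a b c n =
  trans (sumTo-cong n (λ i → ℚP.*-distribʳ-+ (c (n ∸ i)) (a i) (b i))) (sumTo-distrib-+ n _ _)

•-⊛ : ∀ k a b → (k • a) ⊛ b ≗ k • (a ⊛ b)
•-⊛ k a b n =
  trans (sumTo-cong n (λ i → ℚP.*-assoc k (a i) (b (n ∸ i)))) (sym (*-distribˡ-sumTo n k _))

⊛-• : ∀ k a b → a ⊛ (k • b) ≗ k • (a ⊛ b)
⊛-• k a b n = trans (sumTo-cong n (λ i → swap (a i) (b (n ∸ i)))) (sym (*-distribˡ-sumTo n k _))
  where
  swap : ∀ x y → x * (k * y) ≡ k * (x * y)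
  swap = solve 3 (λ k x y → x :* (k :* y) := k :* (x :* y)) refl k

⊖-⊛ : ∀ a b → (⊖ a) ⊛ b ≗ ⊖ (a ⊛ b)
⊖-⊛ a b n =
  trans (sumTo-cong n (λ i → sym (ℚP.neg-distribˡ-* (a i) (b (n ∸ i))))) (sym (neg-distrib-sumTo n _))

⊛-⊖ : ∀ a b → a ⊛ (⊖ b) ≗ ⊖ (a ⊛ b)
⊛-⊖ a b n =
  trans (sumTo-cong n (λ i → sym (ℚP.neg-distribʳ-* (a i) (b (n ∸ i))))) (sym (neg-distrib-sumTo n _))

⊛-zeroʳ : ∀ a → a ⊛ zeros ≗ zeros
⊛-zeroʳ a n = trans (sumTo-cong n (λ i → ℚP.*-zeroʳ (a i))) (sumTo-zero n)

⊛-identityˡ : ∀ a → one ⊛ a ≗ a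
⊛-identityˡ a zero = ℚP.*-identityˡ (a 0)
⊛-identityˡ a (suc n) = begin
    (one ⊛ a) (suc n)
  ≡⟨ ⊛-sucˡ one a n ⟩
    1ℚ * a (suc n) + (zeros ⊛ a) n
  ≡⟨ cong (λ x → 1ℚ * a (suc n) + x) (trans (⊛-comm zeros a n) (⊛-zeroʳ a n)) ⟩
    1ℚ * a (suc n) + 0ℚ
  ≡⟨ solve 1 (λ x → con 1ℚ :* x :+ con 0ℚ := x) refl (a (suc n)) ⟩
    a (suc n)
  ∎
  where open ≡-Reasoning

⊛-identityʳ : ∀ a → a ⊛ one ≗ a
⊛-identityʳ a = ≗-trans (⊛-comm a one) (⊛-identityˡ a)

⊛-assoc : ∀ a b c → (a ⊛ b) ⊛ c ≗ a ⊛ (b ⊛ c)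
⊛-assoc a b c zero = ℚP.*-assoc (a 0) (b 0) (c 0)
⊛-assoc a b c (suc n) = begin
    ((a ⊛ b) ⊛ c) (suc n)
  ≡⟨ ⊛-sucˡ (a ⊛ b) c n ⟩
    a 0 * b 0 * c (suc n) + (tail (a ⊛ b) ⊛ c) n
  ≡⟨ cong (λ x → a 0 * b 0 * c (suc n) + x) (⊛-congʳ (⊛-sucˡ a b) c n) ⟩
    a 0 * b 0 * c (suc n) + (((a 0 • tail b) ⊕ (tail a ⊛ b)) ⊛ c) n
  ≡⟨ cong (λ x → a 0 * b 0 * c (suc n) + x)
       (trans (⊛-distribʳ-⊕ (a 0 • tail b) (tail a ⊛ b) c n)
              (cong (_+ ((tail a ⊛ b) ⊛ c) n) (•-⊛ (a 0) (tail b) c n))) ⟩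
    a 0 * b 0 * c (suc n) + (a 0 * (tail b ⊛ c) n + ((tail a ⊛ b) ⊛ c) n)
  ≡⟨ solve 5 (λ x y z T U → x :* y :* z :+ (x :* T :+ U) := x :* (y :* z :+ T) :+ U) refl
       (a 0) (b 0) (c (suc n)) ((tail b ⊛ c) n) (((tail a ⊛ b) ⊛ c) n) ⟩
    a 0 * (b 0 * c (suc n) + (tail b ⊛ c) n) + ((tail a ⊛ b) ⊛ c) n
  ≡⟨ cong₂ (λ x y → a 0 * x + y) (sym (⊛-sucˡ b c n)) (⊛-assoc (tail a) b c n) ⟩
    a 0 * (b ⊛ c) (suc n) + (tail a ⊛ (b ⊛ c)) n
  ≡⟨ sym (⊛-sucˡ a (b ⊛ c) n) ⟩
    (a ⊛ (b ⊛ c)) (suc n)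
  ∎
  where open ≡-Reasoning

⊛-sumTo : ∀ a (b : ℕ → Series) n N →
          sumTo n (λ m → (a ⊛ b m) N) ≡ (a ⊛ (λ j → sumTo n (λ m → b m j))) N
⊛-sumTo a b n N = sym (trans (sumTo-cong N (λ i → *-distribˡ-sumTo n (a i) (λ m → b m (N ∸ i))))
  (sumTo-comm N n (λ i m → a i * b m (N ∸ i))))

⊛-commutativeSemigroup : CommutativeSemigroup 0ℓ 0ℓ
⊛-commutativeSemigroup = record
  { Carrier = Series
  ; _≈_ = _≗_
  ; _∙_ = _⊛_
  ; isCommutativeSemigroup = record
    { isSemigroup = record
      { isMagma = record
        { isEquivalence = Setoid.isEquivalence (ℕ →-setoid ℚ)
        ; ∙-cong = λ {a} {b} {c} {d} a≗b c≗d → ≗-trans (⊛-congʳ a≗b c) (⊛-congˡ b c≗d)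
        }
      ; assoc = ⊛-assoc
      }
    ; comm = ⊛-comm
    }
  }

open import Algebra.Properties.CommutativeSemigroup ⊛-commutativeSemigroup
  using (x∙yz≈y∙xz; x∙yz≈z∙xy; xy∙z≈y∙xz)

-- Defs builds inv from a private helper; abstracting over its arguments lets unification name it F.
private
  capture : (a : Series) → Σ (ℕ → List ℚ → ℚ) λ F → ∀ n → inv a (suc n) ≡ - F 0 (invRev a n)
  capture a = F , unfold
    where
    F : ℕ → List ℚ → ℚ
    F = _
    unfold : ∀ n → inv a (suc n) ≡ - F 0 (invRev a n)
    unfold n with invRev a n | zero
    ... | xs | i = refl

invDot : Series → ℕ → List ℚ → ℚ
invDot a = proj₁ (capture a)

invDot-invRev : ∀ a n i →
                invDot a i (invRev a n) ≡ sumTo n (λ j → a (suc (i ℕ.+ j)) * inv a (n ∸ j))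
invDot-invRev a zero i =
  trans (ℚP.+-identityʳ (a (suc i) * 1ℚ)) (cong (λ j → a (suc j) * 1ℚ) (sym (ℕP.+-identityʳ i)))
invDot-invRev a (suc n) i = begin
    a (suc i) * inv a (suc n) + invDot a (suc i) (invRev a n)
  ≡⟨ cong (λ x → a (suc i) * inv a (suc n) + x) (invDot-invRev a n (suc i)) ⟩
    a (suc i) * inv a (suc n) + sumTo n (λ j → a (suc (suc i ℕ.+ j)) * inv a (n ∸ j))
  ≡⟨ cong₂ _+_
       (cong (λ j → a (suc j) * inv a (suc n)) (sym (ℕP.+-identityʳ i)))
       (sumTo-cong n (λ j → cong (λ k → a (suc k) * inv a (n ∸ j)) (sym (ℕP.+-suc i j)))) ⟩
    a (suc (i ℕ.+ 0)) * inv a (suc n) + sumTo n (λ j → a (suc (i ℕ.+ suc j)) * inv a (n ∸ j))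
  ≡⟨ sym (sumTo-sucˡ n (λ j → a (suc (i ℕ.+ j)) * inv a (suc n ∸ j))) ⟩
    sumTo (suc n) (λ j → a (suc (i ℕ.+ j)) * inv a (suc n ∸ j))
  ∎
  where open ≡-Reasoning

inv-suc : ∀ a n → inv a (suc n) ≡ - (tail a ⊛ inv a) n
inv-suc a n = cong -_ (invDot-invRev a n 0)

⊛-inverseʳ : ∀ a → a 0 ≡ 1ℚ → a ⊛ inv a ≗ one
⊛-inverseʳ a a₀≡1 zero = cong (_* 1ℚ) a₀≡1
⊛-inverseʳ a a₀≡1 (suc n) = begin
    (a ⊛ inv a) (suc n)
  ≡⟨ ⊛-sucˡ a (inv a) n ⟩
    a 0 * inv a (suc n) + (tail a ⊛ inv a) n
  ≡⟨ cong₂ (λ x y → x * y + (tail a ⊛ inv a) n) a₀≡1 (inv-suc a n) ⟩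
    1ℚ * - (tail a ⊛ inv a) n + (tail a ⊛ inv a) n
  ≡⟨ solve 1 (λ x → con 1ℚ :* (:- x) :+ x := con 0ℚ) refl ((tail a ⊛ inv a) n) ⟩
    0ℚ
  ∎
  where open ≡-Reasoning

inverseˡ-unique : ∀ a b → a 0 ≡ 1ℚ → b ⊛ a ≗ one → b ≗ inv a
inverseˡ-unique a b a₀≡1 ba≗1 n = begin
    b n
  ≡⟨ sym (⊛-identityʳ b n) ⟩
    (b ⊛ one) n
  ≡⟨ ⊛-congˡ b (≗-sym (⊛-inverseʳ a a₀≡1)) n ⟩
    (b ⊛ (a ⊛ inv a)) n
  ≡⟨ sym (⊛-assoc b a (inv a) n) ⟩
    ((b ⊛ a) ⊛ inv a) n
  ≡⟨ ⊛-congʳ ba≗1 (inv a) n ⟩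
    (one ⊛ inv a) n
  ≡⟨ ⊛-identityˡ (inv a) n ⟩
    inv a n
  ∎
  where open ≡-Reasoning

shift-⊛ : ∀ a b → shift a ⊛ b ≗ shift (a ⊛ b)
shift-⊛ a b zero = ℚP.*-zeroˡ (b 0)
shift-⊛ a b (suc n) =
  trans (⊛-sucˡ (shift a) b n)
        (trans (cong (_+ (a ⊛ b) n) (ℚP.*-zeroˡ (b (suc n)))) (ℚP.+-identityˡ ((a ⊛ b) n)))

⊛-shift-suc : ∀ a b n → (a ⊛ shift b) (suc n) ≡ (a ⊛ b) n
⊛-shift-suc a b n =
  trans (⊛-comm a (shift b) (suc n)) (trans (shift-⊛ b a (suc n)) (⊛-comm b a n))

pow-shift-< : ∀ a {k j} → j < k → pow (shift a) k j ≡ 0ℚ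
pow-shift-< a {suc k} {zero} _ = shift-⊛ a (pow (shift a) k) 0
pow-shift-< a {suc k} {suc j} (s≤s j<k) = begin
    (shift a ⊛ pow (shift a) k) (suc j)
  ≡⟨ shift-⊛ a (pow (shift a) k) (suc j) ⟩
    (a ⊛ pow (shift a) k) j
  ≡⟨ ⊛-congˡ-≤ a j (λ i i≤j → pow-shift-< a (ℕP.≤-<-trans i≤j j<k)) ⟩
    (a ⊛ zeros) j
  ≡⟨ ⊛-zeroʳ a j ⟩
    0ℚ
  ∎
  where open ≡-Reasoning

pow-suc-⊛-cancel : ∀ {a b} → b ⊛ a ≗ one → ∀ j → pow b (suc j) ⊛ a ≗ pow b j
pow-suc-⊛-cancel {a} {b} ba≗1 j =
  ≗-trans (xy∙z≈y∙xz b (pow b j) a)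
          (≗-trans (⊛-congˡ (pow b j) ba≗1) (⊛-identityʳ (pow b j)))

diagonal : Series → Series → Series
diagonal F b i = (F ⊛ pow b i) i

-- (λa)^k b^k = λ^k when b a = 1.
diagonal-shift : ∀ {a b} → b ⊛ a ≗ one →
                 ∀ F k i → diagonal F b i ≡ ((F ⊛ pow b (k ℕ.+ i)) ⊛ pow (shift a) k) (k ℕ.+ i)
diagonal-shift ba≗1 F zero i = sym (⊛-identityʳ (F ⊛ pow _ i) i)
diagonal-shift {a} {b} ba≗1 F (suc k) i = trans (diagonal-shift ba≗1 F k i) (sym step)
  where
  open ≡-Reasoning
  j = k ℕ.+ i
  A = F ⊛ pow b (suc j)
  step : (A ⊛ pow (shift a) (suc k)) (suc j) ≡ ((F ⊛ pow b j) ⊛ pow (shift a) k) j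
  step = begin
      (A ⊛ (shift a ⊛ pow (shift a) k)) (suc j)
    ≡⟨ ⊛-congˡ A (shift-⊛ a (pow (shift a) k)) (suc j) ⟩
      (A ⊛ shift (a ⊛ pow (shift a) k)) (suc j)
    ≡⟨ ⊛-shift-suc A (a ⊛ pow (shift a) k) j ⟩
      (A ⊛ (a ⊛ pow (shift a) k)) j
    ≡⟨ sym (⊛-assoc A a (pow (shift a) k) j) ⟩
      ((A ⊛ a) ⊛ pow (shift a) k) j
    ≡⟨ ⊛-congʳ (≗-trans (⊛-assoc F (pow b (suc j)) a)
                        (⊛-congˡ F (pow-suc-⊛-cancel {a} ba≗1 j)))
               (pow (shift a) k) j ⟩
      ((F ⊛ pow b j) ⊛ pow (shift a) k) j
    ∎

powerSum : Series → ℕ → Series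
powerSum y n j = sumTo n (λ m → pow y m j)

geometric-sum : ∀ y n → (one ⊕ ⊖ y) ⊛ powerSum y n ≗ one ⊕ ⊖ pow y (suc n)
geometric-sum y zero j =
  trans (⊛-identityʳ (one ⊕ ⊖ y) j) (cong (λ x → one j + - x) (sym (⊛-identityʳ y j)))
geometric-sum y (suc n) j = begin
    ((one ⊕ ⊖ y) ⊛ (powerSum y n ⊕ yⁿ⁺¹)) j
  ≡⟨ ⊛-distribˡ-⊕ (one ⊕ ⊖ y) (powerSum y n) yⁿ⁺¹ j ⟩
    ((one ⊕ ⊖ y) ⊛ powerSum y n) j + ((one ⊕ ⊖ y) ⊛ yⁿ⁺¹) j
  ≡⟨ cong₂ _+_ (geometric-sum y n j) (trans (⊛-distribʳ-⊕ one (⊖ y) yⁿ⁺¹ j)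
       (cong₂ _+_ (⊛-identityˡ yⁿ⁺¹ j) (⊖-⊛ y yⁿ⁺¹ j))) ⟩
    (one j + - yⁿ⁺¹ j) + (yⁿ⁺¹ j + - (y ⊛ yⁿ⁺¹) j)
  ≡⟨ solve 3 (λ o x z → (o :+ (:- x)) :+ (x :+ (:- z)) := o :+ (:- z)) refl
       (one j) (yⁿ⁺¹ j) ((y ⊛ yⁿ⁺¹) j) ⟩
    one j + - (y ⊛ yⁿ⁺¹) j
  ∎
  where
  open ≡-Reasoning
  yⁿ⁺¹ = pow y (suc n)

-- The Euler operator θ = λ d/dλ

θ : Series → Series
θ a n = ι n * a n

θ-tail : ∀ a → tail (θ a) ≗ θ (tail a) ⊕ tail a
θ-tail a n = solve 2 (λ i x → (con 1ℚ :+ i) :* x := i :* x :+ x) refl (ι n) (a (suc n))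

θ-⊛ : ∀ a b → θ (a ⊛ b) ≗ θ a ⊛ b ⊕ a ⊛ θ b
θ-⊛ a b zero =
  solve 2 (λ x y → con 0ℚ :* (x :* y) := con 0ℚ :* x :* y :+ x :* (con 0ℚ :* y)) refl (a 0) (b 0)
θ-⊛ a b (suc n) = begin
    ι (suc n) * (a ⊛ b) (suc n)
  ≡⟨ cong (ι (suc n) *_) (⊛-sucˡ a b n) ⟩
    ι (suc n) * (a 0 * b (suc n) + T)
  ≡⟨ solve 4 (λ i x y T → (con 1ℚ :+ i) :* (x :* y :+ T)
                        := (con 0ℚ :* x :* y :+ T) :+ (x :* ((con 1ℚ :+ i) :* y) :+ i :* T))
       refl (ι n) (a 0) (b (suc n)) T ⟩
    (θ a 0 * b (suc n) + T) + (a 0 * θ b (suc n) + θ (tail a ⊛ b) n)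
  ≡⟨ cong (λ x → (θ a 0 * b (suc n) + T) + (a 0 * θ b (suc n) + x)) (θ-⊛ (tail a) b n) ⟩
    (θ a 0 * b (suc n) + T) + (a 0 * θ b (suc n) + ((θ (tail a) ⊛ b) n + (tail a ⊛ θ b) n))
  ≡⟨ solve 5 (λ Z T W P Q → (Z :+ T) :+ (W :+ (P :+ Q)) := (Z :+ (P :+ T)) :+ (W :+ Q))
       refl (θ a 0 * b (suc n)) T (a 0 * θ b (suc n)) ((θ (tail a) ⊛ b) n) ((tail a ⊛ θ b) n) ⟩
    (θ a 0 * b (suc n) + ((θ (tail a) ⊛ b) n + T)) + (a 0 * θ b (suc n) + (tail a ⊛ θ b) n)
  ≡⟨ cong₂ (λ x y → (θ a 0 * b (suc n) + x) + y)
       (sym (trans (⊛-congʳ (θ-tail a) b n) (⊛-distribʳ-⊕ (θ (tail a)) (tail a) b n)))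
       (sym (⊛-sucˡ a (θ b) n)) ⟩
    (θ a 0 * b (suc n) + (tail (θ a) ⊛ b) n) + (a ⊛ θ b) (suc n)
  ≡⟨ cong (_+ (a ⊛ θ b) (suc n)) (sym (⊛-sucˡ (θ a) b n)) ⟩
    (θ a ⊛ b) (suc n) + (a ⊛ θ b) (suc n)
  ∎
  where
  open ≡-Reasoning
  T = (tail a ⊛ b) n

θ-one : θ one ≗ zeros
θ-one zero = refl
θ-one (suc n) = ℚP.*-zeroʳ (ι (suc n))

θ-pow : ∀ m a → θ (pow a (suc m)) ≗ ι (suc m) • (pow a m ⊛ θ a)
θ-pow zero a n = begin
    θ (a ⊛ one) n
  ≡⟨ θ-⊛ a one n ⟩
    (θ a ⊛ one) n + (a ⊛ θ one) n
  ≡⟨ cong₂ _+_ (⊛-identityʳ (θ a) n) (trans (⊛-congˡ a θ-one n) (⊛-zeroʳ a n)) ⟩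
    θ a n + 0ℚ
  ≡⟨ solve 1 (λ x → x :+ con 0ℚ := (con 1ℚ :+ con 0ℚ) :* x) refl (θ a n) ⟩
    ι 1 * θ a n
  ≡⟨ cong (ι 1 *_) (sym (⊛-identityˡ (θ a) n)) ⟩
    ι 1 * (one ⊛ θ a) n
  ∎
  where open ≡-Reasoning
θ-pow (suc m) a n = begin
    θ (a ⊛ pow a (suc m)) n
  ≡⟨ θ-⊛ a (pow a (suc m)) n ⟩
    (θ a ⊛ pow a (suc m)) n + (a ⊛ θ (pow a (suc m))) n
  ≡⟨ cong₂ _+_ (⊛-comm (θ a) (pow a (suc m)) n) (⊛-congˡ a (θ-pow m a) n) ⟩
    (pow a (suc m) ⊛ θ a) n + (a ⊛ (ι (suc m) • (pow a m ⊛ θ a))) n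
  ≡⟨ cong (λ x → (pow a (suc m) ⊛ θ a) n + x)
       (trans (⊛-• (ι (suc m)) a (pow a m ⊛ θ a) n)
              (cong (ι (suc m) *_) (sym (⊛-assoc a (pow a m) (θ a) n)))) ⟩
    (pow a (suc m) ⊛ θ a) n + ι (suc m) * (pow a (suc m) ⊛ θ a) n
  ≡⟨ solve 2 (λ i x → x :+ i :* x := (con 1ℚ :+ i) :* x) refl
       (ι (suc m)) ((pow a (suc m) ⊛ θ a) n) ⟩
    ι (suc (suc m)) * (pow a (suc m) ⊛ θ a) n
  ∎
  where open ≡-Reasoning

θ-shift-one : θ (shift one) ≗ shift one
θ-shift-one zero = refl
θ-shift-one (suc zero) = refl
θ-shift-one (suc (suc n)) = ℚP.*-zeroʳ (ι (suc (suc n)))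

alternate : Series → Series
alternate a n = sgn n * a n

alternate-⊛ : ∀ a b → alternate (a ⊛ b) ≗ alternate a ⊛ alternate b
alternate-⊛ a b n = trans (*-distribˡ-sumTo n (sgn n) _) (sumTo-cong-≤ n split)
  where
  split : ∀ i → i ≤ n → sgn n * (a i * b (n ∸ i)) ≡ sgn i * a i * (sgn (n ∸ i) * b (n ∸ i))
  split i i≤n = begin
      sgn n * (a i * b (n ∸ i))
    ≡⟨ cong (λ k → sgn k * (a i * b (n ∸ i))) (sym (ℕP.m+[n∸m]≡n i≤n)) ⟩
      sgn (i ℕ.+ (n ∸ i)) * (a i * b (n ∸ i))
    ≡⟨ cong (_* (a i * b (n ∸ i))) (sgn-+ i (n ∸ i)) ⟩
      sgn i * sgn (n ∸ i) * (a i * b (n ∸ i))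
    ≡⟨ solve 4 (λ s t x y → s :* t :* (x :* y) := s :* x :* (t :* y)) refl
         (sgn i) (sgn (n ∸ i)) (a i) (b (n ∸ i)) ⟩
      sgn i * a i * (sgn (n ∸ i) * b (n ∸ i))
    ∎
    where open ≡-Reasoning

alternate-one : alternate one ≗ one
alternate-one zero = refl
alternate-one (suc n) = ℚP.*-zeroʳ (sgn (suc n))

alternate-involutive : ∀ a → alternate (alternate a) ≗ a
alternate-involutive a n = trans (sym (ℚP.*-assoc (sgn n) (sgn n) (a n)))
  (trans (cong (_* a n) (sgn*sgn≡1 n)) (ℚP.*-identityˡ (a n)))

-- The expansion of e^{−λ}/(1 − e^{−λ})^k

E : Series
E = expNeg

h : Series
h = oneMinusExpNegOverλ

H : Series
H = inv h

X : Series
X = shift h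

-- e^{−λ} = (λh)′ = h + λh′
E≗h⊕θh : E ≗ h ⊕ θ h
E≗h⊕θh n = begin
    sgn n * recip (n !)
  ≡⟨ cong (sgn n *_) (sym (recip-!-suc n)) ⟩
    sgn n * ((1ℚ + ι n) * r)
  ≡⟨ solve 3 (λ s i x → s :* ((con 1ℚ :+ i) :* x) := s :* x :+ i :* (s :* x)) refl
       (sgn n) (ι n) r ⟩
    sgn n * r + ι n * (sgn n * r)
  ∎
  where
  open ≡-Reasoning
  instance _ = n !≢0
  r = recip (suc n !) {{suc n !≢0}}

one⊖X≗E : one ⊕ ⊖ X ≗ E
one⊖X≗E zero = refl
one⊖X≗E (suc n) =
  solve 2 (λ s x → con 0ℚ :+ (:- (s :* x)) := (:- s) :* x) refl (sgn n) (recip (suc n !) {{suc n !≢0}})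

θX≗shiftE : θ X ≗ shift E
θX≗shiftE zero = refl
θX≗shiftE (suc n) =
  trans (solve 2 (λ i x → (con 1ℚ :+ i) :* x := x :+ i :* x) refl (ι n) (h n)) (sym (E≗h⊕θh n))

h⊛H≗one : h ⊛ H ≗ one
h⊛H≗one = ⊛-inverseʳ h refl

H⊛h≗one : H ⊛ h ≗ one
H⊛h≗one = ≗-trans (⊛-comm H h) h⊛H≗one

θh≗E⊖h : θ h ≗ E ⊕ ⊖ h
θh≗E⊖h n =
  trans (solve 2 (λ t x → t := (x :+ t) :+ (:- x)) refl (θ h n) (h n))
        (cong (_+ (- h n)) (sym (E≗h⊕θh n)))

E⊛H≗one⊖h⊛θH : E ⊛ H ≗ one ⊕ ⊖ (h ⊛ θ H)
E⊛H≗one⊖h⊛θH n = begin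
    (E ⊛ H) n
  ≡⟨ solve 3 (λ e o t → e := (e :+ (:- o) :+ t) :+ (o :+ (:- t))) refl
       ((E ⊛ H) n) (one n) ((h ⊛ θ H) n) ⟩
    ((E ⊛ H) n + - one n + (h ⊛ θ H) n) + (one n + - (h ⊛ θ H) n)
  ≡⟨ cong (_+ (one n + - (h ⊛ θ H) n)) vanish ⟩
    0ℚ + (one n + - (h ⊛ θ H) n)
  ≡⟨ ℚP.+-identityˡ _ ⟩
    one n + - (h ⊛ θ H) n
  ∎
  where
  open ≡-Reasoning
  θh⊛H : (θ h ⊛ H) n ≡ (E ⊛ H) n + - one n
  θh⊛H = begin
      (θ h ⊛ H) n
    ≡⟨ ⊛-congʳ θh≗E⊖h H n ⟩
      ((E ⊕ ⊖ h) ⊛ H) n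
    ≡⟨ ⊛-distribʳ-⊕ E (⊖ h) H n ⟩
      (E ⊛ H) n + ((⊖ h) ⊛ H) n
    ≡⟨ cong (λ x → (E ⊛ H) n + x) (trans (⊖-⊛ h H n) (cong -_ (h⊛H≗one n))) ⟩
      (E ⊛ H) n + - one n
    ∎
  vanish : (E ⊛ H) n + - one n + (h ⊛ θ H) n ≡ 0ℚ
  vanish = begin
      (E ⊛ H) n + - one n + (h ⊛ θ H) n
    ≡⟨ cong (_+ (h ⊛ θ H) n) (sym θh⊛H) ⟩
      (θ h ⊛ H) n + (h ⊛ θ H) n
    ≡⟨ sym (θ-⊛ h H n) ⟩
      θ (h ⊛ H) n
    ≡⟨ cong (ι n *_) (h⊛H≗one n) ⟩
      θ one n
    ≡⟨ θ-one n ⟩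
      0ℚ
    ∎

E⊛H²≗H⊖θH : E ⊛ (H ⊛ H) ≗ H ⊕ ⊖ θ H
E⊛H²≗H⊖θH n = begin
    (E ⊛ (H ⊛ H)) n
  ≡⟨ sym (⊛-assoc E H H n) ⟩
    ((E ⊛ H) ⊛ H) n
  ≡⟨ ⊛-congʳ E⊛H≗one⊖h⊛θH H n ⟩
    ((one ⊕ ⊖ (h ⊛ θ H)) ⊛ H) n
  ≡⟨ ⊛-distribʳ-⊕ one (⊖ (h ⊛ θ H)) H n ⟩
    (one ⊛ H) n + ((⊖ (h ⊛ θ H)) ⊛ H) n
  ≡⟨ cong₂ _+_ (⊛-identityˡ H n) (trans (⊖-⊛ (h ⊛ θ H) H n) (cong -_ h⊛θH⊛H)) ⟩
    H n + - θ H n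
  ∎
  where
  open ≡-Reasoning
  h⊛θH⊛H : ((h ⊛ θ H) ⊛ H) n ≡ θ H n
  h⊛θH⊛H = trans (xy∙z≈y∙xz h (θ H) H n)
                 (trans (⊛-congˡ (θ H) h⊛H≗one n) (⊛-identityʳ (θ H) n))

E⊛H^[2+m]≗H^[1+m]⊖H^m⊛θH : ∀ m →
                            E ⊛ pow H (suc (suc m)) ≗ pow H (suc m) ⊕ ⊖ (pow H m ⊛ θ H)
E⊛H^[2+m]≗H^[1+m]⊖H^m⊛θH m n = begin
    (E ⊛ (H ⊛ (H ⊛ pow H m))) n
  ≡⟨ ≗-trans (⊛-congˡ E (x∙yz≈z∙xy H H (pow H m))) (x∙yz≈y∙xz E (pow H m) (H ⊛ H)) n ⟩
    (pow H m ⊛ (E ⊛ (H ⊛ H))) n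
  ≡⟨ ⊛-congˡ (pow H m) E⊛H²≗H⊖θH n ⟩
    (pow H m ⊛ (H ⊕ ⊖ θ H)) n
  ≡⟨ ⊛-distribˡ-⊕ (pow H m) H (⊖ θ H) n ⟩
    (pow H m ⊛ H) n + (pow H m ⊛ (⊖ θ H)) n
  ≡⟨ cong₂ _+_ (⊛-comm (pow H m) H n) (⊛-⊖ (pow H m) (θ H) n) ⟩
    pow H (suc m) n + - (pow H m ⊛ θ H) n
  ∎
  where open ≡-Reasoning

-- The residue of dX/X^{n+1}.  At λ^{m+1}, θ(H^{m+1}) = (m+1) H^m θH makes the
-- right-hand side of the identity above vanish.
E⊛H^[1+n]-residue : ∀ n → (E ⊛ pow H (suc n)) n ≡ one n
E⊛H^[1+n]-residue zero = refl
E⊛H^[1+n]-residue (suc m) = begin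
    (E ⊛ pow H (suc (suc m))) (suc m)
  ≡⟨ E⊛H^[2+m]≗H^[1+m]⊖H^m⊛θH m (suc m) ⟩
    pow H (suc m) (suc m) + - (pow H m ⊛ θ H) (suc m)
  ≡⟨ cong (λ x → pow H (suc m) (suc m) + - x) (ι-cancel m (sym (θ-pow m H (suc m)))) ⟩
    pow H (suc m) (suc m) + - pow H (suc m) (suc m)
  ≡⟨ ℚP.+-inverseʳ (pow H (suc m) (suc m)) ⟩
    0ℚ
  ∎
  where open ≡-Reasoning

-- A truncation of −log(1 − X) = λ.
logSum : ℕ → Series
logSum n j = sumTo n (λ m → recip (suc m) * pow X (suc m) j)

logSum≡shift-one : ∀ n j → j ≤ suc n → logSum n j ≡ shift one j
logSum≡shift-one n zero _ = trans (sumTo-cong n vanish) (sumTo-zero n)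
  where
  vanish : ∀ m → recip (suc m) * pow X (suc m) 0 ≡ 0ℚ
  vanish m = trans (cong (recip (suc m) *_) (pow-shift-< h {suc m} (s≤s z≤n)))
                   (ℚP.*-zeroʳ (recip (suc m)))
logSum≡shift-one n (suc j) (s≤s j≤n) = ι-cancel j (trans θlogSum (sym (θ-shift-one (suc j))))
  where
  open ≡-Reasoning
  term : ∀ m → ι (suc j) * (recip (suc m) * pow X (suc m) (suc j)) ≡ (E ⊛ pow X m) j
  term m = begin
      ι (suc j) * (recip (suc m) * pow X (suc m) (suc j))
    ≡⟨ solve 3 (λ i r x → i :* (r :* x) := r :* (i :* x)) refl
         (ι (suc j)) (recip (suc m)) (pow X (suc m) (suc j)) ⟩
      recip (suc m) * θ (pow X (suc m)) (suc j)
    ≡⟨ cong (recip (suc m) *_) (θ-pow m X (suc j)) ⟩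
      recip (suc m) * (ι (suc m) * (pow X m ⊛ θ X) (suc j))
    ≡⟨ sym (ℚP.*-assoc (recip (suc m)) (ι (suc m)) _) ⟩
      recip (suc m) * ι (suc m) * (pow X m ⊛ θ X) (suc j)
    ≡⟨ cong (_* (pow X m ⊛ θ X) (suc j))
            (trans (ℚP.*-comm (recip (suc m)) (ι (suc m))) (ι*recip≡1 m)) ⟩
      1ℚ * (pow X m ⊛ θ X) (suc j)
    ≡⟨ ℚP.*-identityˡ _ ⟩
      (pow X m ⊛ θ X) (suc j)
    ≡⟨ ⊛-congˡ (pow X m) θX≗shiftE (suc j) ⟩
      (pow X m ⊛ shift E) (suc j)
    ≡⟨ ⊛-shift-suc (pow X m) E j ⟩
      (pow X m ⊛ E) j
    ≡⟨ ⊛-comm (pow X m) E j ⟩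
      (E ⊛ pow X m) j
    ∎
  θlogSum : θ (logSum n) (suc j) ≡ one j
  θlogSum = begin
      ι (suc j) * logSum n (suc j)
    ≡⟨ *-distribˡ-sumTo n (ι (suc j)) _ ⟩
      sumTo n (λ m → ι (suc j) * (recip (suc m) * pow X (suc m) (suc j)))
    ≡⟨ sumTo-cong n term ⟩
      sumTo n (λ m → (E ⊛ pow X m) j)
    ≡⟨ ⊛-sumTo E (pow X) n j ⟩
      (E ⊛ powerSum X n) j
    ≡⟨ ⊛-congʳ (≗-sym one⊖X≗E) (powerSum X n) j ⟩
      ((one ⊕ ⊖ X) ⊛ powerSum X n) j
    ≡⟨ geometric-sum X n j ⟩
      one j + - pow X (suc n) j
    ≡⟨ cong (λ x → one j + - x) (pow-shift-< h (s≤s j≤n)) ⟩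
      one j + - 0ℚ
    ≡⟨ ℚP.+-identityʳ (one j) ⟩
      one j
    ∎

recipSuc : Series
recipSuc m = recip (suc m)

diagonal⊛recipSuc≗one : diagonal E H ⊛ recipSuc ≗ one
diagonal⊛recipSuc≗one n = begin
    (diagonal E H ⊛ recipSuc) n
  ≡⟨ ⊛-comm (diagonal E H) recipSuc n ⟩
    sumTo n (λ m → recipSuc m * diagonal E H (n ∸ m))
  ≡⟨ sumTo-cong-≤ n (λ m m≤n → cong (recipSuc m *_) (diagonal-at m m≤n)) ⟩
    sumTo n (λ m → recipSuc m * (A ⊛ pow X (suc m)) (suc n))
  ≡⟨ sumTo-cong n (λ m → sym (⊛-• (recipSuc m) A (pow X (suc m)) (suc n))) ⟩
    sumTo n (λ m → (A ⊛ (recipSuc m • pow X (suc m))) (suc n))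
  ≡⟨ ⊛-sumTo A (λ m → recipSuc m • pow X (suc m)) n (suc n) ⟩
    (A ⊛ logSum n) (suc n)
  ≡⟨ ⊛-congˡ-≤ A (suc n) (logSum≡shift-one n) ⟩
    (A ⊛ shift one) (suc n)
  ≡⟨ ⊛-shift-suc A one n ⟩
    (A ⊛ one) n
  ≡⟨ ⊛-identityʳ A n ⟩
    A n
  ≡⟨ E⊛H^[1+n]-residue n ⟩
    one n
  ∎
  where
  open ≡-Reasoning
  A = E ⊛ pow H (suc n)
  diagonal-at : ∀ m → m ≤ n → diagonal E H (n ∸ m) ≡ (A ⊛ pow X (suc m)) (suc n)
  diagonal-at m m≤n = subst (λ i → diagonal E H (n ∸ m) ≡ ((E ⊛ pow H i) ⊛ pow X (suc m)) i)
                            (cong suc (ℕP.m+[n∸m]≡n m≤n)) (diagonal-shift H⊛h≗one E (suc m) (n ∸ m))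

alternate-diagonal≗G : alternate (diagonal E H) ≗ G
alternate-diagonal≗G = inverseˡ-unique logOverX (alternate (diagonal E H)) refl λ n → begin
    (alternate (diagonal E H) ⊛ alternate recipSuc) n
  ≡⟨ sym (alternate-⊛ (diagonal E H) recipSuc n) ⟩
    alternate (diagonal E H ⊛ recipSuc) n
  ≡⟨ cong (sgn n *_) (diagonal⊛recipSuc≗one n) ⟩
    alternate one n
  ≡⟨ alternate-one n ⟩
    one n
  ∎
  where open ≡-Reasoning

mainTheorem2 : ∀ (k : ℕ) → 1 ≤ k → laurentCoeff k (+ 0) ≡ sgn k * G k
mainTheorem2 k _ = begin
    diagonal E H k
  ≡⟨ sym (alternate-involutive (diagonal E H) k) ⟩
    sgn k * alternate (diagonal E H) k
  ≡⟨ cong (sgn k *_) (alternate-diagonal≗G k) ⟩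
    sgn k * G k
  ∎
  where open ≡-Reasoning
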